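{- Let $n\ge 2$. Then $$\mathrm{LLT}_{K_n}(\mathbf{x};q)+q[n-2]_q\,\mathrm{LLT}_{K_n^{(n-1)}}(\mathbf{x};q)=[n-1]_q\,\mathrm{LLT}_{K_n^{(n-2)}}(\mathbf{x};q).$$ More generally, for $2\le\ell\le n-1$ and $1\le k\le \ell-1$, $$[\ell-k]_q\,\mathrm{LLT}_{K_n}(\mathbf{x};q)+q^{\ell-k}[k]_q\,\mathrm{LLT}_{K_n^{(\ell)}}(\mathbf{x};q)=[\ell]_q\,\mathrm{LLT}_{K_n^{(k)}}(\mathbf{x};q).$$
   Context: $[k]_q=1+q+\dots+q^{k-1}$ ($[0]_q=0$). $K_n$ is the complete graph on $[n]$. For $0\le k\le n-1$, $K_n^{(k)}$ is the graph on $[n]$ obtained from $K_n$ by deleting the $k$ edges $\{1,j\}$ for $n-k+1\le j\le n$ (equivalently, the graph with area sequence $(n-k-1,n-2,n-3,\dots,1,0)$, i.e. edges $\{i,j\}$ with $i<j\le i+a_i$). For a graph $G$ on $[n]$, $\mathrm{LLT}_G(\mathbf{x};q)=\sum_{\kappa}q^{\mathrm{asc}(\kappa)}x^\kappa$ over all maps $\kappa:[n]\to\mathbb{Z}_{>0}$, where $\mathrm{asc}(\kappa)$ is the number of edges $\{j,k\}$ with $j<k$ and $\kappa(j)<\kappa(k)$, and $x^\kappa=\prod_jx_{\kappa(j)}$. -}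

module Defs where

open import Data.Nat using (ℕ; zero; suc; _+_; _*_; _∸_; _≤_; _<_; _<ᵇ_; _≡ᵇ_)
open import Data.Nat.Properties using (_≟_)
import Data.Bool as B
open import Data.Bool using (Bool; true; false; if_then_else_; _∧_; not)
open import Data.Fin using (Fin; toℕ)
open import Data.List using (List; []; _∷_; [_]; map; concatMap; foldr; replicate; _++_; allFin; length; filter)
open import Data.Vec using (Vec; []; _∷_; tabulate; lookup)
import Data.Vec.Properties as VP
open import Data.Product using (_×_; _,_)
open import Relation.Nullary.Decidable using (⌊_⌋)
open import Relation.Binary.PropositionalEquality using (_≡_)

-- Polynomials in q with ℕ coefficients: coefficient list, index i = coefficient of q^i.

Poly : Set
Poly = List ℕ

infixl 6 _⊕_
infixl 7 _⊛_

_⊕_ : Poly → Poly → Poly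
[] ⊕ r = r
(a ∷ p) ⊕ [] = a ∷ p
(a ∷ p) ⊕ (b ∷ r) = (a + b) ∷ (p ⊕ r)

_⊛_ : Poly → Poly → Poly
[] ⊛ r = []
(a ∷ p) ⊛ r = map (a *_) r ⊕ (0 ∷ (p ⊛ r))

qpow : ℕ → Poly
qpow k = replicate k 0 ++ [ 1 ]

qint : ℕ → Poly
qint k = replicate k 1

coeff : Poly → ℕ → ℕ
coeff [] i = 0
coeff (a ∷ p) zero = a
coeff (a ∷ p) (suc i) = coeff p i

-- equality of polynomials (coefficientwise; trailing zeros irrelevant)
_≈ₚ_ : Poly → Poly → Set
p ≈ₚ r = ∀ i → coeff p i ≡ coeff r i

-- Graphs on [n] (vertices Fin n, vertex i ↔ i+1); G i j for i < j says {i,j} is an edge.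

Graph : ℕ → Set
Graph n = Fin n → Fin n → Bool

K : (n : ℕ) → Graph n
K n i j = true

-- K_n^(k): delete edges {1,j} for n-k+1 ≤ j ≤ n, i.e. (0-based) i = 0 and j ≥ n-k
Kk : (n k : ℕ) → Graph n
Kk n k i j = not ((toℕ i ≡ᵇ 0) ∧ ((n ∸ k) ≤ᵇ' toℕ j))
  where
  _≤ᵇ'_ : ℕ → ℕ → Bool
  a ≤ᵇ' b = a <ᵇ suc b

-- colourings κ : [n] → [m] (the first m variables x_1..x_m), as vectors

allMaps : (n m : ℕ) → List (Vec (Fin m) n)
allMaps zero m = [ [] ]
allMaps (suc n) m = concatMap (λ c → map (c ∷_) (allMaps n m)) (allFin m)

asc : {n m : ℕ} → Graph n → Vec (Fin m) n → ℕ
asc {n} G κ = length (filter (λ p → isAsc p B.≟ true)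
                        (concatMap (λ j → map (j ,_) (allFin n)) (allFin n)))
  where
  isAsc : Fin n × Fin n → Bool
  isAsc (j , k) = (toℕ j <ᵇ toℕ k) ∧ G j k ∧ (toℕ (lookup κ j) <ᵇ toℕ (lookup κ k))

-- content of κ: exponent vector of x^κ
content : {n m : ℕ} → Vec (Fin m) n → Vec ℕ m
content {n} κ = tabulate (λ c → length (filter (λ j → toℕ (lookup κ j) ≟ toℕ c) (allFin n)))

-- coefficient of the monomial x_1^{α_1} ⋯ x_m^{α_m} in LLT_G(x;q), a polynomial in q
LLTcoeff : {n m : ℕ} → Graph n → Vec ℕ m → Poly
LLTcoeff {n} {m} G α =
  foldr _⊕_ [] (map (λ κ → if ⌊ VP.≡-dec _≟_ (content κ) α ⌋ then qpow (asc G κ) else [])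
                    (allMaps n m))

module Submission where

-- Write a colouring of the n = N + 1 vertices as c ∷ u, c the colour of vertex 1.
-- In K_n^(k) vertex 1 is adjacent exactly to the next N - k vertices, so every
-- graph in the statement has as coefficient of x^α a term of the sequence
--   Φ(d) = Σ_{c,u of content α} q^(prefix c d u + asc_{K_N}(u))      (d ≤ N),
-- where prefix c d u counts the first d entries of u larger than c (K_n gives
-- Φ(N)). Exchanging the colours of vertices d + 2 and d + 3 preserves content;
-- symmetrising over this exchange, plus a case check on the relative order of
-- three colours, gives the local recurrence Φ(d + 2) + q Φ(d) = (1 + q) Φ(d + 1).
-- Pure algebra then turns the recurrence into the interpolation identity
--   [a] Φ(i + a + b) + q^a [b] Φ(i) = [a + b] Φ(i + a),
-- which at i = N - ℓ, a = ℓ - k, b = k is the proposition.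

open import Defs
open import Data.Nat using (ℕ; _∸_; _≤_; _+_)
open import Data.Vec using (Vec)
open import Data.Product using (_×_)

open import Level using (0ℓ)
open import Function.Bundles using (Equivalence)
open import Data.Unit using (tt)
open import Data.Empty using (⊥-elim)
open import Data.Product using (_,_)
open import Data.Bool using (Bool; true; false; _∧_; not; if_then_else_; T)
import Data.Bool as Bool
open import Data.Bool.Properties using (T-∧; T-≡)
open import Data.Nat using (zero; suc; _*_; _<_; _<ᵇ_; _≡ᵇ_; s≤s; s≤s⁻¹)
open import Data.Nat.Properties as ℕ using (_≟_)
open import Data.Nat.Tactic.RingSolver using (solve-∀)
open import Data.Fin using (Fin; toℕ) renaming (zero to fzero; suc to fsuc)
open import Data.List using (List; []; _∷_; [_]; map; foldr; _++_; concatMap; tabulate; allFin; filter; length)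
open import Data.Vec using ([]; _∷_; lookup)
import Data.Vec.Properties as Vec
open import Relation.Nullary using (¬_; does; yes; no)
open import Relation.Nullary.Decidable using (⌊_⌋)
open import Relation.Unary using (Pred; Decidable)
open import Relation.Binary.Bundles using (Setoid)
open import Relation.Binary.Structures using (IsEquivalence)
open import Relation.Binary.Definitions using (tri<; tri≈; tri>)
open import Relation.Binary.PropositionalEquality as ≡ using (_≡_; refl; cong; cong₂)
import Relation.Binary.Reasoning.Setoid
open import Algebra.Bundles using (CommutativeSemiring)
open import Algebra.Structures.Biased using (IsCommutativeMonoidˡ; IsCommutativeSemiringˡ)
open import Algebra.Properties.CommutativeSemigroup ℕ.+-commutativeSemigroup using (x∙yz≈y∙xz; interchange)

-- Coefficientwise equality, wrapped in a record so that Agda can infer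
-- both polynomials from an equation (the bare function type ≈ₚ cannot).
infix 4 _≋_
record _≋_ (p r : Poly) : Set where
  constructor by-coeffs
  field coeffs : p ≈ₚ r
open _≋_

≋-isEquivalence : IsEquivalence _≋_
≋-isEquivalence = record
  { refl  = by-coeffs λ _ → refl
  ; sym   = λ e → by-coeffs λ i → ≡.sym (coeffs e i)
  ; trans = λ e f → by-coeffs λ i → ≡.trans (coeffs e i) (coeffs f i)
  }

≋-setoid : Setoid _ _
≋-setoid = record { isEquivalence = ≋-isEquivalence }

module ≋-Reasoning = Relation.Binary.Reasoning.Setoid ≋-setoid

open Setoid ≋-setoid using () renaming (refl to ≋-refl; sym to ≋-sym; trans to ≋-trans; reflexive to ≋-reflexive)

scale : ℕ → Poly → Poly
scale a = map (a *_)

coeff-⊕ : ∀ p r i → coeff (p ⊕ r) i ≡ coeff p i + coeff r i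
coeff-⊕ []      r       i       = refl
coeff-⊕ (a ∷ p) []      i       = ≡.sym (ℕ.+-identityʳ _)
coeff-⊕ (a ∷ p) (b ∷ r) zero    = refl
coeff-⊕ (a ∷ p) (b ∷ r) (suc i) = coeff-⊕ p r i

coeff-scale : ∀ a r i → coeff (scale a r) i ≡ a * coeff r i
coeff-scale a []      i       = ≡.sym (ℕ.*-zeroʳ a)
coeff-scale a (b ∷ r) zero    = refl
coeff-scale a (b ∷ r) (suc i) = coeff-scale a r i

coeff-⊛ : ∀ a p r i → coeff ((a ∷ p) ⊛ r) i ≡ a * coeff r i + coeff (0 ∷ (p ⊛ r)) i
coeff-⊛ a p r i = ≡.trans (coeff-⊕ (scale a r) (0 ∷ (p ⊛ r)) i) (cong (_+ _) (coeff-scale a r i))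

cons-cong : ∀ {a p r} → p ≋ r → (a ∷ p) ≋ (a ∷ r)
cons-cong e = by-coeffs λ { zero → refl ; (suc i) → coeffs e i }

⊕-cong : ∀ {p p′ r r′} → p ≋ p′ → r ≋ r′ → (p ⊕ r) ≋ (p′ ⊕ r′)
⊕-cong {p} {p′} {r} {r′} e f = by-coeffs λ i → begin
  coeff (p ⊕ r) i           ≡⟨ coeff-⊕ p r i ⟩
  coeff p i + coeff r i     ≡⟨ cong₂ _+_ (coeffs e i) (coeffs f i) ⟩
  coeff p′ i + coeff r′ i   ≡⟨ coeff-⊕ p′ r′ i ⟨
  coeff (p′ ⊕ r′) i         ∎
  where open ≡.≡-Reasoning

⊕-assoc : ∀ p r s → ((p ⊕ r) ⊕ s) ≋ (p ⊕ (r ⊕ s))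
⊕-assoc p r s = by-coeffs λ i → begin
  coeff ((p ⊕ r) ⊕ s) i               ≡⟨ coeff-⊕ (p ⊕ r) s i ⟩
  coeff (p ⊕ r) i + coeff s i         ≡⟨ cong (_+ coeff s i) (coeff-⊕ p r i) ⟩
  coeff p i + coeff r i + coeff s i   ≡⟨ ℕ.+-assoc (coeff p i) _ _ ⟩
  coeff p i + (coeff r i + coeff s i) ≡⟨ cong (coeff p i +_) (coeff-⊕ r s i) ⟨
  coeff p i + coeff (r ⊕ s) i         ≡⟨ coeff-⊕ p (r ⊕ s) i ⟨
  coeff (p ⊕ (r ⊕ s)) i               ∎
  where open ≡.≡-Reasoning

⊕-comm : ∀ p r → (p ⊕ r) ≋ (r ⊕ p)
⊕-comm p r = by-coeffs λ i →
  ≡.trans (coeff-⊕ p r i) (≡.trans (ℕ.+-comm (coeff p i) _) (≡.sym (coeff-⊕ r p i)))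

scale-cong : ∀ a {r r′} → r ≋ r′ → scale a r ≋ scale a r′
scale-cong a {r} {r′} e = by-coeffs λ i →
  ≡.trans (coeff-scale a r i) (≡.trans (cong (a *_) (coeffs e i)) (≡.sym (coeff-scale a r′ i)))

⊛-congˡ : ∀ p {r r′} → r ≋ r′ → (p ⊛ r) ≋ (p ⊛ r′)
⊛-congˡ []      e = ≋-refl
⊛-congˡ (a ∷ p) e = ⊕-cong (scale-cong a e) (cons-cong (⊛-congˡ p e))

⊛-zeroʳ : ∀ p → (p ⊛ []) ≋ []
⊛-zeroʳ []      = ≋-refl
⊛-zeroʳ (a ∷ p) = by-coeffs λ
  { zero    → ℕ.+-identityʳ _
  ; (suc i) → coeffs (⊛-zeroʳ p) i }

⊛-consʳ : ∀ r a p → (r ⊛ (a ∷ p)) ≋ (scale a r ⊕ (0 ∷ (r ⊛ p)))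
⊛-consʳ []      a p = by-coeffs λ { zero → refl ; (suc i) → refl }
⊛-consʳ (b ∷ r) a p = by-coeffs λ
  { zero    → cong (_+ 0) (ℕ.*-comm b a)
  ; (suc i) → begin
      coeff (scale b p ⊕ r ⊛ (a ∷ p)) i
        ≡⟨ coeff-⊕ (scale b p) _ i ⟩
      coeff (scale b p) i + coeff (r ⊛ (a ∷ p)) i
        ≡⟨ cong (_+ _) (coeff-scale b p i) ⟩
      b * coeff p i + coeff (r ⊛ (a ∷ p)) i
        ≡⟨ cong (b * coeff p i +_) (coeffs (⊛-consʳ r a p) i) ⟩
      b * coeff p i + coeff (scale a r ⊕ (0 ∷ (r ⊛ p))) i
        ≡⟨ cong (b * coeff p i +_) (coeff-⊕ (scale a r) _ i) ⟩
      b * coeff p i + (coeff (scale a r) i + coeff (0 ∷ (r ⊛ p)) i)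
        ≡⟨ x∙yz≈y∙xz (b * coeff p i) (coeff (scale a r) i) _ ⟩
      coeff (scale a r) i + (b * coeff p i + coeff (0 ∷ (r ⊛ p)) i)
        ≡⟨ cong (coeff (scale a r) i +_) (coeff-⊛ b r p i) ⟨
      coeff (scale a r) i + coeff ((b ∷ r) ⊛ p) i
        ≡⟨ coeff-⊕ (scale a r) _ i ⟨
      coeff (scale a r ⊕ ((b ∷ r) ⊛ p)) i ∎ }
  where open ≡.≡-Reasoning

⊛-comm : ∀ p r → (p ⊛ r) ≋ (r ⊛ p)
⊛-comm []      r = ≋-sym (⊛-zeroʳ r)
⊛-comm (a ∷ p) r = ≋-trans (⊕-cong ≋-refl (cons-cong (⊛-comm p r))) (≋-sym (⊛-consʳ r a p))

⊛-cong : ∀ {p p′ r r′} → p ≋ p′ → r ≋ r′ → (p ⊛ r) ≋ (p′ ⊛ r′)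
⊛-cong {p} {p′} {r} {r′} e f =
  ≋-trans (⊛-comm p r) (≋-trans (⊛-congˡ r e) (≋-trans (⊛-comm r p′) (⊛-congˡ p′ f)))

-- Congruences with the fixed operand explicit, so that it need not be inferred.
⊛-congʳ : ∀ r {p p′} → p ≋ p′ → (p ⊛ r) ≋ (p′ ⊛ r)
⊛-congʳ r e = ⊛-cong e ≋-refl

⊕-congˡ : ∀ p {r r′} → r ≋ r′ → (p ⊕ r) ≋ (p ⊕ r′)
⊕-congˡ p e = ⊕-cong ≋-refl e

⊕-congʳ : ∀ r {p p′} → p ≋ p′ → (p ⊕ r) ≋ (p′ ⊕ r)
⊕-congʳ r e = ⊕-cong e ≋-refl

⊛-distribʳ : ∀ r p p′ → ((p ⊕ p′) ⊛ r) ≋ ((p ⊛ r) ⊕ (p′ ⊛ r))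
⊛-distribʳ r []      p′       = ≋-refl
⊛-distribʳ r (a ∷ p) []       = ≋-sym (by-coeffs λ i → ≡.trans (coeff-⊕ ((a ∷ p) ⊛ r) [] i) (ℕ.+-identityʳ _))
⊛-distribʳ r (a ∷ p) (b ∷ p′) = by-coeffs λ i → begin
  coeff (((a + b) ∷ (p ⊕ p′)) ⊛ r) i
    ≡⟨ coeff-⊛ (a + b) (p ⊕ p′) r i ⟩
  (a + b) * coeff r i + coeff (0 ∷ ((p ⊕ p′) ⊛ r)) i
    ≡⟨ cong ((a + b) * coeff r i +_) (coeffs (cons-cong (⊛-distribʳ r p p′)) i) ⟩
  (a + b) * coeff r i + coeff ((0 ∷ (p ⊛ r)) ⊕ (0 ∷ (p′ ⊛ r))) i
    ≡⟨ cong ((a + b) * coeff r i +_) (coeff-⊕ (0 ∷ (p ⊛ r)) (0 ∷ (p′ ⊛ r)) i) ⟩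
  (a + b) * coeff r i + (coeff (0 ∷ (p ⊛ r)) i + coeff (0 ∷ (p′ ⊛ r)) i)
    ≡⟨ regroup a b (coeff r i) _ _ ⟩
  (a * coeff r i + coeff (0 ∷ (p ⊛ r)) i) + (b * coeff r i + coeff (0 ∷ (p′ ⊛ r)) i)
    ≡⟨ cong₂ _+_ (coeff-⊛ a p r i) (coeff-⊛ b p′ r i) ⟨
  coeff ((a ∷ p) ⊛ r) i + coeff ((b ∷ p′) ⊛ r) i
    ≡⟨ coeff-⊕ ((a ∷ p) ⊛ r) _ i ⟨
  coeff (((a ∷ p) ⊛ r) ⊕ ((b ∷ p′) ⊛ r)) i ∎
  where
  open ≡.≡-Reasoning
  regroup : ∀ a b c x y → (a + b) * c + (x + y) ≡ (a * c + x) + (b * c + y)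
  regroup = solve-∀

scale-⊛ : ∀ a r s → (scale a r ⊛ s) ≋ scale a (r ⊛ s)
scale-⊛ a []      s = ≋-refl
scale-⊛ a (b ∷ r) s = by-coeffs λ i → begin
  coeff ((a * b ∷ scale a r) ⊛ s) i
    ≡⟨ coeff-⊛ (a * b) (scale a r) s i ⟩
  a * b * coeff s i + coeff (0 ∷ (scale a r ⊛ s)) i
    ≡⟨ cong (a * b * coeff s i +_) (coeffs (≋-trans (cons-cong (scale-⊛ a r s)) shift-scale) i) ⟩
  a * b * coeff s i + coeff (scale a (0 ∷ (r ⊛ s))) i
    ≡⟨ cong (a * b * coeff s i +_) (coeff-scale a (0 ∷ (r ⊛ s)) i) ⟩
  a * b * coeff s i + a * coeff (0 ∷ (r ⊛ s)) i
    ≡⟨ factor a b (coeff s i) _ ⟩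
  a * (b * coeff s i + coeff (0 ∷ (r ⊛ s)) i)
    ≡⟨ cong (a *_) (coeff-⊛ b r s i) ⟨
  a * coeff ((b ∷ r) ⊛ s) i
    ≡⟨ coeff-scale a ((b ∷ r) ⊛ s) i ⟨
  coeff (scale a ((b ∷ r) ⊛ s)) i ∎
  where
  open ≡.≡-Reasoning
  shift-scale : (0 ∷ scale a (r ⊛ s)) ≋ scale a (0 ∷ (r ⊛ s))
  shift-scale = by-coeffs λ { zero → ≡.sym (ℕ.*-zeroʳ a) ; (suc i) → refl }
  factor : ∀ a b c x → a * b * c + a * x ≡ a * (b * c + x)
  factor = solve-∀

shift-⊛ : ∀ x s → ((0 ∷ x) ⊛ s) ≋ (0 ∷ (x ⊛ s))
shift-⊛ x s = by-coeffs λ i → ≡.trans (coeff-⊛ 0 x s i) (cong (_+ coeff (0 ∷ (x ⊛ s)) i) (ℕ.*-zeroˡ (coeff s i)))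

⊛-assoc : ∀ p r s → ((p ⊛ r) ⊛ s) ≋ (p ⊛ (r ⊛ s))
⊛-assoc []      r s = ≋-refl
⊛-assoc (a ∷ p) r s = begin
  (scale a r ⊕ (0 ∷ (p ⊛ r))) ⊛ s          ≈⟨ ⊛-distribʳ s (scale a r) (0 ∷ (p ⊛ r)) ⟩
  scale a r ⊛ s ⊕ (0 ∷ (p ⊛ r)) ⊛ s        ≈⟨ ⊕-cong (scale-⊛ a r s) (shift-⊛ (p ⊛ r) s) ⟩
  scale a (r ⊛ s) ⊕ (0 ∷ ((p ⊛ r) ⊛ s))    ≈⟨ ⊕-cong ≋-refl (cons-cong (⊛-assoc p r s)) ⟩
  scale a (r ⊛ s) ⊕ (0 ∷ (p ⊛ (r ⊛ s)))    ∎
  where open ≋-Reasoning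

⊛-identityˡ : ∀ p → ([ 1 ] ⊛ p) ≋ p
⊛-identityˡ p = by-coeffs λ i → ≡.trans (coeff-⊛ 1 [] p i) (≡.trans (cong₂ _+_ (ℕ.*-identityˡ _) (vanishes i)) (ℕ.+-identityʳ _))
  where
  vanishes : ∀ i → coeff (0 ∷ []) i ≡ 0
  vanishes zero    = refl
  vanishes (suc i) = refl

polynomials : CommutativeSemiring _ _
polynomials = record
  { Carrier = Poly ; _≈_ = _≋_ ; _+_ = _⊕_ ; _*_ = _⊛_ ; 0# = [] ; 1# = [ 1 ]
  ; isCommutativeSemiring = IsCommutativeSemiringˡ.isCommutativeSemiring record
    { +-isCommutativeMonoid = IsCommutativeMonoidˡ.isCommutativeMonoid record
      { isSemigroup = record { isMagma = record { isEquivalence = ≋-isEquivalence ; ∙-cong = ⊕-cong } ; assoc = ⊕-assoc }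
      ; identityˡ = λ _ → ≋-refl
      ; comm = ⊕-comm }
    ; *-isCommutativeMonoid = IsCommutativeMonoidˡ.isCommutativeMonoid record
      { isSemigroup = record { isMagma = record { isEquivalence = ≋-isEquivalence ; ∙-cong = ⊛-cong } ; assoc = ⊛-assoc }
      ; identityˡ = ⊛-identityˡ
      ; comm = ⊛-comm }
    ; distribʳ = ⊛-distribʳ
    ; zeroˡ = λ _ → ≋-refl
    }
  }

import Algebra.Solver.Ring.NaturalCoefficients.Default polynomials as PolySolver
open PolySolver using (solve; _:+_; _:*_; _:=_)

⊕-cancelʳ : ∀ {a b} z → (a ⊕ z) ≋ (b ⊕ z) → a ≋ b
⊕-cancelʳ {a} {b} z e = by-coeffs λ i → ℕ.+-cancelʳ-≡ (coeff z i) (coeff a i) (coeff b i)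
  (≡.trans (≡.sym (coeff-⊕ a z i)) (≡.trans (coeffs e i) (coeff-⊕ b z i)))

⊕-halve : ∀ {p r} → (p ⊕ p) ≋ (r ⊕ r) → p ≋ r
⊕-halve {p} {r} e = by-coeffs λ i → ℕ.*-cancelˡ-≡ (coeff p i) (coeff r i) 2 (begin
  2 * coeff p i             ≡⟨ cong (coeff p i +_) (ℕ.+-identityʳ (coeff p i)) ⟩
  coeff p i + coeff p i     ≡⟨ coeff-⊕ p p i ⟨
  coeff (p ⊕ p) i           ≡⟨ coeffs e i ⟩
  coeff (r ⊕ r) i           ≡⟨ coeff-⊕ r r i ⟩
  coeff r i + coeff r i     ≡⟨ cong (coeff r i +_) (ℕ.+-identityʳ (coeff r i)) ⟨
  2 * coeff r i             ∎)
  where open ≡.≡-Reasoning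

q : Poly
q = qpow 1

q-⊛ : ∀ x → (q ⊛ x) ≋ (0 ∷ x)
q-⊛ x = ≋-trans (shift-⊛ [ 1 ] x) (cons-cong (⊛-identityˡ x))

qpow-suc : ∀ j → qpow (suc j) ≋ (q ⊛ qpow j)
qpow-suc j = ≋-sym (q-⊛ (qpow j))

qpow-+ : ∀ a b → qpow (a + b) ≋ (qpow a ⊛ qpow b)
qpow-+ zero    b = ≋-sym (⊛-identityˡ (qpow b))
qpow-+ (suc a) b = ≋-trans (cons-cong (qpow-+ a b)) (≋-sym (shift-⊛ (qpow a) (qpow b)))

qint-suc : ∀ j → qint (suc j) ≋ (qint j ⊕ qpow j)
qint-suc zero    = ≋-refl
qint-suc (suc j) = cons-cong (qint-suc j)

qint-+ : ∀ a b → qint (a + b) ≋ (qint a ⊕ qpow a ⊛ qint b)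
qint-+ zero    b = ≋-sym (⊛-identityˡ (qint b))
qint-+ (suc a) b = ≋-trans (cons-cong (qint-+ a b)) (≋-sym (⊕-congˡ (qint (suc a)) (shift-⊛ (qpow a) (qint b))))

-- Sequences satisfying the three-term recurrence
--   Φ(p + 2) - Φ(p + 1) = q (Φ(p + 1) - Φ(p)),
-- written without subtraction.

Recurrence : Poly → Poly → Poly → Set
Recurrence A B C = (A ⊕ q ⊛ C) ≋ (B ⊕ q ⊛ B)

module ThreeTerm (Φ : ℕ → Poly) (N : ℕ)
  (recurrence : ∀ p → suc (suc p) ≤ N → Recurrence (Φ (suc (suc p))) (Φ (suc p)) (Φ p)) where

  open ≋-Reasoning

  -- The differences are geometric: Φ(i + j + 1) - Φ(i + j) = q^j (Φ(i + 1) - Φ(i)).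
  geometric : ∀ i j → suc (i + j) ≤ N →
              (Φ (suc (i + j)) ⊕ qpow j ⊛ Φ i) ≋ (Φ (i + j) ⊕ qpow j ⊛ Φ (suc i))
  geometric i zero    _ rewrite ℕ.+-identityʳ i =
    ≋-trans (⊕-congˡ (Φ (suc i)) (⊛-identityˡ (Φ i)))
      (≋-trans (⊕-comm (Φ (suc i)) (Φ i)) (⊕-congˡ (Φ i) (≋-sym (⊛-identityˡ (Φ (suc i))))))
  geometric i (suc j) le rewrite ℕ.+-suc i j = ⊕-cancelʳ Z (begin
    (A₂ ⊕ qpow (suc j) ⊛ P₀) ⊕ Z        ≈⟨ ⊕-congʳ Z (⊕-congˡ A₂ (⊛-congʳ P₀ (qpow-suc j))) ⟩
    (A₂ ⊕ (q ⊛ D) ⊛ P₀) ⊕ Z             ≈⟨ solve 6 (λ A₂ A₁ A₀ P₀ D q →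
                                            (A₂ :+ (q :* D) :* P₀) :+ (q :* A₀ :+ q :* A₁)
                                         := (A₂ :+ q :* A₀) :+ q :* (A₁ :+ D :* P₀)) ≋-refl A₂ A₁ A₀ P₀ D q ⟩
    (A₂ ⊕ q ⊛ A₀) ⊕ q ⊛ (A₁ ⊕ D ⊛ P₀)  ≈⟨ ⊕-cong (recurrence (i + j) le) (⊛-congˡ q (geometric i j le′)) ⟩
    (A₁ ⊕ q ⊛ A₁) ⊕ q ⊛ (A₀ ⊕ D ⊛ P₁)  ≈⟨ solve 6 (λ A₁ A₀ P₁ D q Z →
                                            (A₁ :+ q :* A₁) :+ q :* (A₀ :+ D :* P₁)
                                         := (A₁ :+ (q :* D) :* P₁) :+ (q :* A₀ :+ q :* A₁)) ≋-refl A₁ A₀ P₁ D q Z ⟩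
    (A₁ ⊕ (q ⊛ D) ⊛ P₁) ⊕ Z             ≈⟨ ⊕-congʳ Z (⊕-congˡ A₁ (⊛-congʳ P₁ (≋-sym (qpow-suc j)))) ⟩
    (A₁ ⊕ qpow (suc j) ⊛ P₁) ⊕ Z        ∎)
    where
    A₂ = Φ (suc (suc (i + j)))
    A₁ = Φ (suc (i + j))
    A₀ = Φ (i + j)
    P₀ = Φ i
    P₁ = Φ (suc i)
    D  = qpow j
    Z  = q ⊛ A₀ ⊕ q ⊛ A₁
    le′ : suc (i + j) ≤ N
    le′ = ℕ.≤-trans (ℕ.n≤1+n _) le

  -- Summing the geometric differences: Φ(i + j) - Φ(i) = [j]_q (Φ(i + 1) - Φ(i)).
  linear : ∀ i j → i + j ≤ N → (Φ (i + j) ⊕ qint j ⊛ Φ i) ≋ (Φ i ⊕ qint j ⊛ Φ (suc i))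
  linear i zero    _ rewrite ℕ.+-identityʳ i = ≋-refl
  linear i (suc j) le rewrite ℕ.+-suc i j = ⊕-cancelʳ (Φ (i + j)) (begin
    (Φ (suc (i + j)) ⊕ qint (suc j) ⊛ P₀) ⊕ Φ (i + j)
      ≈⟨ ⊕-congʳ (Φ (i + j)) (⊕-congˡ (Φ (suc (i + j))) (⊛-congʳ P₀ (qint-suc j))) ⟩
    (Φ (suc (i + j)) ⊕ (I ⊕ D) ⊛ P₀) ⊕ Φ (i + j)
      ≈⟨ solve 6 (λ S T I D P₀ P₁ → (S :+ (I :+ D) :* P₀) :+ T := (T :+ I :* P₀) :+ (S :+ D :* P₀))
           ≋-refl (Φ (suc (i + j))) (Φ (i + j)) I D P₀ P₁ ⟩
    (Φ (i + j) ⊕ I ⊛ P₀) ⊕ (Φ (suc (i + j)) ⊕ D ⊛ P₀)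
      ≈⟨ ⊕-cong (linear i j (ℕ.≤-trans (ℕ.n≤1+n _) le)) (geometric i j le) ⟩
    (P₀ ⊕ I ⊛ P₁) ⊕ (Φ (i + j) ⊕ D ⊛ P₁)
      ≈⟨ solve 6 (λ S T I D P₀ P₁ → (P₀ :+ I :* P₁) :+ (T :+ D :* P₁) := (P₀ :+ (I :+ D) :* P₁) :+ T)
           ≋-refl (Φ (suc (i + j))) (Φ (i + j)) I D P₀ P₁ ⟩
    (P₀ ⊕ (I ⊕ D) ⊛ P₁) ⊕ Φ (i + j)
      ≈⟨ ⊕-congʳ (Φ (i + j)) (⊕-congˡ P₀ (⊛-congʳ P₁ (≋-sym (qint-suc j)))) ⟩
    (P₀ ⊕ qint (suc j) ⊛ P₁) ⊕ Φ (i + j) ∎)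
    where
    P₀ = Φ i
    P₁ = Φ (suc i)
    I  = qint j
    D  = qpow j

  -- The interpolation identity [a] Φ(i+a+b) + q^a [b] Φ(i) = [a+b] Φ(i+a), obtained
  -- by comparing linear (i, a + b) and linear (i, a) after adding [a][a+b] Φ(i).
  interpolation : ∀ i a b → i + (a + b) ≤ N →
    (qint a ⊛ Φ (i + (a + b)) ⊕ (qpow a ⊛ qint b) ⊛ Φ i) ≋ (qint (a + b) ⊛ Φ (i + a))
  interpolation i a b le = ⊕-cancelʳ ((Iₐ ⊛ Iₐ₊ᵦ) ⊛ P₀) (begin
    (Iₐ ⊛ A ⊕ (Qₐ ⊛ Iᵦ) ⊛ P₀) ⊕ (Iₐ ⊛ Iₐ₊ᵦ) ⊛ P₀
      ≈⟨ solve 7 (λ Iₐ Iᵦ Qₐ Iₐ₊ᵦ A P₀ P₁ → (Iₐ :* A :+ (Qₐ :* Iᵦ) :* P₀) :+ (Iₐ :* Iₐ₊ᵦ) :* P₀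
                  := Iₐ :* (A :+ Iₐ₊ᵦ :* P₀) :+ (Qₐ :* Iᵦ) :* P₀) ≋-refl Iₐ Iᵦ Qₐ Iₐ₊ᵦ A P₀ P₁ ⟩
    Iₐ ⊛ (A ⊕ Iₐ₊ᵦ ⊛ P₀) ⊕ (Qₐ ⊛ Iᵦ) ⊛ P₀
      ≈⟨ ⊕-congʳ ((Qₐ ⊛ Iᵦ) ⊛ P₀) (⊛-congˡ Iₐ (linear i (a + b) le)) ⟩
    Iₐ ⊛ (P₀ ⊕ Iₐ₊ᵦ ⊛ P₁) ⊕ (Qₐ ⊛ Iᵦ) ⊛ P₀
      ≈⟨ solve 7 (λ Iₐ Iᵦ Qₐ Iₐ₊ᵦ A P₀ P₁ → Iₐ :* (P₀ :+ Iₐ₊ᵦ :* P₁) :+ (Qₐ :* Iᵦ) :* P₀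
                  := (Iₐ :+ Qₐ :* Iᵦ) :* P₀ :+ (Iₐ :* Iₐ₊ᵦ) :* P₁) ≋-refl Iₐ Iᵦ Qₐ Iₐ₊ᵦ A P₀ P₁ ⟩
    (Iₐ ⊕ Qₐ ⊛ Iᵦ) ⊛ P₀ ⊕ (Iₐ ⊛ Iₐ₊ᵦ) ⊛ P₁
      ≈⟨ ⊕-congʳ ((Iₐ ⊛ Iₐ₊ᵦ) ⊛ P₁) (⊛-congʳ P₀ (≋-sym (qint-+ a b))) ⟩
    Iₐ₊ᵦ ⊛ P₀ ⊕ (Iₐ ⊛ Iₐ₊ᵦ) ⊛ P₁
      ≈⟨ solve 4 (λ Iₐ Iₐ₊ᵦ P₀ P₁ → Iₐ₊ᵦ :* P₀ :+ (Iₐ :* Iₐ₊ᵦ) :* P₁ := Iₐ₊ᵦ :* (P₀ :+ Iₐ :* P₁))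
           ≋-refl Iₐ Iₐ₊ᵦ P₀ P₁ ⟩
    Iₐ₊ᵦ ⊛ (P₀ ⊕ Iₐ ⊛ P₁)
      ≈⟨ ⊛-congˡ Iₐ₊ᵦ (≋-sym (linear i a (ℕ.≤-trans (ℕ.+-monoʳ-≤ i (ℕ.m≤m+n a b)) le))) ⟩
    Iₐ₊ᵦ ⊛ (B ⊕ Iₐ ⊛ P₀)
      ≈⟨ solve 4 (λ Iₐ Iₐ₊ᵦ B P₀ → Iₐ₊ᵦ :* (B :+ Iₐ :* P₀) := Iₐ₊ᵦ :* B :+ (Iₐ :* Iₐ₊ᵦ) :* P₀)
           ≋-refl Iₐ Iₐ₊ᵦ B P₀ ⟩
    Iₐ₊ᵦ ⊛ B ⊕ (Iₐ ⊛ Iₐ₊ᵦ) ⊛ P₀ ∎)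
    where
    Iₐ   = qint a
    Iᵦ   = qint b
    Qₐ   = qpow a
    Iₐ₊ᵦ = qint (a + b)
    A    = Φ (i + (a + b))
    B    = Φ (i + a)
    P₀   = Φ i
    P₁   = Φ (suc i)

private variable A B : Set

∑ : List A → (A → Poly) → Poly
∑ xs f = foldr _⊕_ [] (map f xs)

∑₂ : List A → (A → A → Poly) → Poly
∑₂ xs F = ∑ xs λ x → ∑ xs λ y → F x y

∑-cong : ∀ (xs : List A) {f g : A → Poly} → (∀ x → f x ≋ g x) → ∑ xs f ≋ ∑ xs g
∑-cong []       e = ≋-refl
∑-cong (x ∷ xs) e = ⊕-cong (e x) (∑-cong xs e)

∑-⊕ : ∀ (xs : List A) (f g : A → Poly) → ∑ xs (λ x → f x ⊕ g x) ≋ (∑ xs f ⊕ ∑ xs g)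
∑-⊕ []       f g = ≋-refl
∑-⊕ (x ∷ xs) f g = begin
  (f x ⊕ g x) ⊕ ∑ xs (λ x → f x ⊕ g x)  ≈⟨ ⊕-congˡ (f x ⊕ g x) (∑-⊕ xs f g) ⟩
  (f x ⊕ g x) ⊕ (∑ xs f ⊕ ∑ xs g)        ≈⟨ solve 4 (λ a b c d → (a :+ b) :+ (c :+ d) := (a :+ c) :+ (b :+ d))
                                              ≋-refl (f x) (g x) (∑ xs f) (∑ xs g) ⟩
  (f x ⊕ ∑ xs f) ⊕ (g x ⊕ ∑ xs g)        ∎
  where open ≋-Reasoning

∑-⊛ˡ : ∀ (xs : List A) (c : Poly) (f : A → Poly) → ∑ xs (λ x → c ⊛ f x) ≋ (c ⊛ ∑ xs f)
∑-⊛ˡ []       c f = ≋-sym (⊛-zeroʳ c)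
∑-⊛ˡ (x ∷ xs) c f = begin
  c ⊛ f x ⊕ ∑ xs (λ x → c ⊛ f x)  ≈⟨ ⊕-congˡ (c ⊛ f x) (∑-⊛ˡ xs c f) ⟩
  c ⊛ f x ⊕ c ⊛ ∑ xs f            ≈⟨ solve 3 (λ c a b → c :* a :+ c :* b := c :* (a :+ b)) ≋-refl c (f x) (∑ xs f) ⟩
  c ⊛ (f x ⊕ ∑ xs f)              ∎
  where open ≋-Reasoning

∑-⊛ʳ : ∀ (xs : List A) (c : Poly) (f : A → Poly) → ∑ xs (λ x → f x ⊛ c) ≋ (∑ xs f ⊛ c)
∑-⊛ʳ xs c f = ≋-trans (∑-cong xs λ x → ⊛-comm (f x) c) (≋-trans (∑-⊛ˡ xs c f) (⊛-comm c (∑ xs f)))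

∑-++ : ∀ (xs ys : List A) (f : A → Poly) → ∑ (xs ++ ys) f ≋ (∑ xs f ⊕ ∑ ys f)
∑-++ []       ys f = ≋-refl
∑-++ (x ∷ xs) ys f = ≋-trans (⊕-congˡ (f x) (∑-++ xs ys f)) (≋-sym (⊕-assoc (f x) (∑ xs f) (∑ ys f)))

∑-swap : ∀ (xs : List A) (ys : List B) (F : A → B → Poly) →
         ∑ xs (λ x → ∑ ys (λ y → F x y)) ≋ ∑ ys (λ y → ∑ xs (λ x → F x y))
∑-swap []       ys F = ≋-sym (∑-zero ys)
  where
  ∑-zero : ∀ {B : Set} (ys : List B) → ∑ ys (λ _ → []) ≋ []
  ∑-zero []       = ≋-refl
  ∑-zero (y ∷ ys) = ∑-zero ys
∑-swap (x ∷ xs) ys F = ≋-trans (⊕-congˡ (∑ ys (F x)) (∑-swap xs ys F)) (≋-sym (∑-⊕ ys (F x) (λ y → ∑ xs (λ x → F x y))))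

∑-map : ∀ (xs : List A) (h : A → B) (f : B → Poly) → ∑ (map h xs) f ≡ ∑ xs (λ x → f (h x))
∑-map []       h f = refl
∑-map (x ∷ xs) h f = cong (f (h x) ⊕_) (∑-map xs h f)

∑-concatMap : ∀ (xs : List A) (g : A → List B) (f : B → Poly) →
              ∑ (concatMap g xs) f ≋ ∑ xs (λ x → ∑ (g x) f)
∑-concatMap []       g f = ≋-refl
∑-concatMap (x ∷ xs) g f = ≋-trans (∑-++ (g x) (concatMap g xs) f) (⊕-congˡ (∑ (g x) f) (∑-concatMap xs g f))

∑-linear : ∀ (xs : List A) (r : Poly) (f g : A → Poly) → ∑ xs (λ x → f x ⊕ r ⊛ g x) ≋ (∑ xs f ⊕ r ⊛ ∑ xs g)
∑-linear xs r f g = ≋-trans (∑-⊕ xs f (λ x → r ⊛ g x)) (⊕-congˡ (∑ xs f) (∑-⊛ˡ xs r g))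

∑₂-linear : ∀ (xs : List A) (r : Poly) (F G : A → A → Poly) →
            ∑₂ xs (λ x y → F x y ⊕ r ⊛ G x y) ≋ (∑₂ xs F ⊕ r ⊛ ∑₂ xs G)
∑₂-linear xs r F G = ≋-trans (∑-cong xs λ x → ∑-linear xs r (F x) (G x)) (∑-linear xs r _ _)

Recurrence-∑ : ∀ (xs : List A) (F G H : A → Poly) → (∀ x → Recurrence (F x) (G x) (H x)) →
               Recurrence (∑ xs F) (∑ xs G) (∑ xs H)
Recurrence-∑ xs F G H r = ≋-trans (≋-sym (∑-linear xs q F H)) (≋-trans (∑-cong xs r) (∑-linear xs q G G))

Recurrence-cong : ∀ {A A′ B B′ C C′} → A ≋ A′ → B ≋ B′ → C ≋ C′ → Recurrence A B C → Recurrence A′ B′ C′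
Recurrence-cong eA eB eC r =
  ≋-trans (≋-sym (⊕-cong eA (⊛-congˡ q eC))) (≋-trans r (⊕-cong eB (⊛-congˡ q eB)))

symmetrise : ∀ {A : Set} (xs : List A) (h T U : A → A → Poly) →
             (∀ x y → h x y ≋ h y x) → (∀ x y → (T x y ⊕ T y x) ≋ (U x y ⊕ U y x)) →
             ∑₂ xs (λ x y → h x y ⊛ T x y) ≋ ∑₂ xs (λ x y → h x y ⊛ U x y)
symmetrise {A} xs h T U h-sym balanced = ⊕-halve (begin
  S T ⊕ S T                                   ≈⟨ doubled T ⟩
  ∑₂ xs (λ x y → h x y ⊛ (T x y ⊕ T y x))     ≈⟨ ∑-cong xs (λ x → ∑-cong xs λ y → ⊛-congˡ (h x y) (balanced x y)) ⟩
  ∑₂ xs (λ x y → h x y ⊛ (U x y ⊕ U y x))     ≈⟨ doubled U ⟨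
  S U ⊕ S U                                   ∎)
  where
  open ≋-Reasoning
  S : (A → A → Poly) → Poly
  S F = ∑₂ xs (λ x y → h x y ⊛ F x y)
  doubled : ∀ (F : A → A → Poly) → (S F ⊕ S F) ≋ ∑₂ xs (λ x y → h x y ⊛ (F x y ⊕ F y x))
  doubled F = begin
    S F ⊕ S F
      ≈⟨ ⊕-congˡ (S F) (∑-swap xs xs (λ x y → h x y ⊛ F x y)) ⟩
    S F ⊕ ∑₂ xs (λ x y → h y x ⊛ F y x)
      ≈⟨ ⊕-congˡ (S F) (∑-cong xs λ x → ∑-cong xs λ y → ⊛-congʳ (F y x) (h-sym y x)) ⟩
    S F ⊕ ∑₂ xs (λ x y → h x y ⊛ F y x)
      ≈⟨ ∑-⊕ xs _ _ ⟨
    ∑ xs (λ x → ∑ xs (λ y → h x y ⊛ F x y) ⊕ ∑ xs (λ y → h x y ⊛ F y x))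
      ≈⟨ ∑-cong xs (λ x → ∑-⊕ xs _ _) ⟨
    ∑₂ xs (λ x y → h x y ⊛ F x y ⊕ h x y ⊛ F y x)
      ≈⟨ ∑-cong xs (λ x → ∑-cong xs λ y → solve 3 (λ a b c → a :* b :+ a :* c := a :* (b :+ c)) ≋-refl (h x y) (F x y) (F y x)) ⟩
    ∑₂ xs (λ x y → h x y ⊛ (F x y ⊕ F y x)) ∎

bit : Bool → ℕ
bit true  = 1
bit false = 0

count : ∀ {n} → (Fin n → Bool) → ℕ
count {zero}  g = 0
count {suc n} g = bit (g fzero) + count (λ j → g (fsuc j))

total : ∀ {n} → (Fin n → ℕ) → ℕ
total {zero}  g = 0
total {suc n} g = g fzero + total (λ j → g (fsuc j))

count-false : ∀ {n} → count {n} (λ _ → false) ≡ 0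
count-false {zero}  = refl
count-false {suc n} = count-false {n}

total-cong : ∀ {n} {f g : Fin n → ℕ} → (∀ j → f j ≡ g j) → total f ≡ total g
total-cong {zero}  e = refl
total-cong {suc n} e = cong₂ _+_ (e fzero) (total-cong (λ j → e (fsuc j)))

countL : (A → Bool) → List A → ℕ
countL Q []       = 0
countL Q (x ∷ xs) = bit (Q x) + countL Q xs

length-filter : ∀ {P : Pred A 0ℓ} (P? : Decidable P) xs → length (filter P? xs) ≡ countL (λ x → does (P? x)) xs
length-filter P? []       = refl
length-filter P? (x ∷ xs) with does (P? x)
... | true  = cong suc (length-filter P? xs)
... | false = length-filter P? xs

countL-++ : ∀ (Q : A → Bool) xs ys → countL Q (xs ++ ys) ≡ countL Q xs + countL Q ys
countL-++ Q []       ys = refl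
countL-++ Q (x ∷ xs) ys = ≡.trans (cong (bit (Q x) +_) (countL-++ Q xs ys)) (≡.sym (ℕ.+-assoc (bit (Q x)) _ _))

countL-map : ∀ (Q : B → Bool) (h : A → B) xs → countL Q (map h xs) ≡ countL (λ x → Q (h x)) xs
countL-map Q h []       = refl
countL-map Q h (x ∷ xs) = cong (bit (Q (h x)) +_) (countL-map Q h xs)

countL-tabulate : ∀ {n} (Q : A → Bool) (f : Fin n → A) → countL Q (tabulate f) ≡ count (λ j → Q (f j))
countL-tabulate {n = zero}  Q f = refl
countL-tabulate {n = suc n} Q f = cong (bit (Q (f fzero)) +_) (countL-tabulate Q (λ j → f (fsuc j)))

countL-concatMap : ∀ {n} (Q : B → Bool) (g : A → List B) (f : Fin n → A) →
                   countL Q (concatMap g (tabulate f)) ≡ total (λ j → countL Q (g (f j)))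
countL-concatMap {n = zero}  Q g f = refl
countL-concatMap {n = suc n} Q g f =
  ≡.trans (countL-++ Q (g (f fzero)) _) (cong (countL Q (g (f fzero)) +_) (countL-concatMap Q g (λ j → f (fsuc j))))

length-filter-allFin : ∀ {n} {P : Pred (Fin n) 0ℓ} (P? : Decidable P) → length (filter P? (allFin n)) ≡ count (λ j → does (P? j))
length-filter-allFin {n} P? = ≡.trans (length-filter P? (allFin n)) (countL-tabulate (λ j → does (P? j)) (λ j → j))

-- Ascents of a colouring whose first vertex is split off

ascent : ∀ {n m} → Graph n → Vec (Fin m) n → Fin n × Fin n → Bool
ascent G κ (j , k) = (toℕ j <ᵇ toℕ k) ∧ G j k ∧ (toℕ (lookup κ j) <ᵇ toℕ (lookup κ k))

asc-total : ∀ {n m} (G : Graph n) (κ : Vec (Fin m) n) → asc G κ ≡ total (λ j → count (λ k → ascent G κ (j , k)))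
asc-total {n} G κ = begin
  length (filter (λ p → ascent G κ p Bool.≟ true) pairs)
    ≡⟨ length-filter (λ p → ascent G κ p Bool.≟ true) pairs ⟩
  countL (λ p → does (ascent G κ p Bool.≟ true)) pairs
    ≡⟨ countL-cong pairs (λ p → does-≟-true (ascent G κ p)) ⟩
  countL (ascent G κ) pairs
    ≡⟨ countL-concatMap (ascent G κ) (λ j → map (j ,_) (allFin n)) (λ j → j) ⟩
  total (λ j → countL (ascent G κ) (map (j ,_) (allFin n)))
    ≡⟨ total-cong (λ j → ≡.trans (countL-map (ascent G κ) (j ,_) (allFin n)) (countL-tabulate (λ k → ascent G κ (j , k)) (λ k → k))) ⟩
  total (λ j → count (λ k → ascent G κ (j , k))) ∎
  where
  open ≡.≡-Reasoning
  pairs = concatMap (λ j → map (j ,_) (allFin n)) (allFin n)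
  does-≟-true : ∀ b → does (b Bool.≟ true) ≡ b
  does-≟-true true  = refl
  does-≟-true false = refl
  countL-cong : ∀ xs {f g : Fin n × Fin n → Bool} → (∀ x → f x ≡ g x) → countL f xs ≡ countL g xs
  countL-cong []       e = refl
  countL-cong (x ∷ xs) e = cong₂ _+_ (cong bit (e x)) (countL-cong xs e)

asc-cons : ∀ {N m} (G : Graph (suc N)) (c : Fin m) (u : Vec (Fin m) N) →
           asc G (c ∷ u) ≡ count (λ j → G fzero (fsuc j) ∧ (toℕ c <ᵇ toℕ (lookup u j)))
                           + asc (λ i j → G (fsuc i) (fsuc j)) u
asc-cons G c u =
  ≡.trans (asc-total G (c ∷ u)) (cong (count (λ j → G fzero (fsuc j) ∧ (toℕ c <ᵇ toℕ (lookup u j))) +_)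
                                     (≡.sym (asc-total (λ i j → G (fsuc i) (fsuc j)) u)))

above : ∀ {m N} → Fin m → Vec (Fin m) N → ℕ
above z v = count (λ k → toℕ z <ᵇ toℕ (lookup v k))

prefix : ∀ {m N} → Fin m → ℕ → Vec (Fin m) N → ℕ
prefix c zero    u       = 0
prefix c (suc d) []      = 0
prefix c (suc d) (z ∷ u) = bit (toℕ c <ᵇ toℕ z) + prefix c d u

asc-K-cons : ∀ {N m} (z : Fin m) (v : Vec (Fin m) N) → asc (K (suc N)) (z ∷ v) ≡ above z v + asc (K N) v
asc-K-cons z v = asc-cons (K _) z v

asc-K : ∀ {N m} (c : Fin m) (u : Vec (Fin m) N) → asc (K (suc N)) (c ∷ u) ≡ prefix c N u + asc (K N) u
asc-K c u = ≡.trans (asc-K-cons c u) (cong (_+ _) (above-prefix u))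
  where
  above-prefix : ∀ {N} (u : Vec _ N) → above c u ≡ prefix c N u
  above-prefix []      = refl
  above-prefix (z ∷ u) = cong (bit (toℕ c <ᵇ toℕ z) +_) (above-prefix u)

asc-Kk : ∀ {N m} k → k ≤ N → (c : Fin m) (u : Vec (Fin m) N) →
         asc (Kk (suc N) k) (c ∷ u) ≡ prefix c (N ∸ k) u + asc (K N) u
asc-Kk {N} k k≤N c u = ≡.trans (asc-cons (Kk (suc N) k) c u) (cong (_+ _) first-row)
  where
  prefix-count : ∀ {N} d (u : Vec _ N) → count (λ j → not (d <ᵇ suc (toℕ j)) ∧ (toℕ c <ᵇ toℕ (lookup u j))) ≡ prefix c d u
  prefix-count zero    []      = refl
  prefix-count (suc d) []      = refl
  prefix-count {suc N} zero (z ∷ u) = count-false {N}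
  prefix-count (suc d) (z ∷ u) = cong (bit (toℕ c <ᵇ toℕ z) +_) (prefix-count d u)
  first-row : count (λ j → Kk (suc N) k fzero (fsuc j) ∧ (toℕ c <ᵇ toℕ (lookup u j))) ≡ prefix c (N ∸ k) u
  first-row rewrite ℕ.+-∸-assoc 1 k≤N = prefix-count (N ∸ k) u

-- exchange p u swaps the entries p and p + 1 of u (counted from 0) when both exist.
exchange : ∀ {n} → ℕ → Vec A n → Vec A n
exchange zero    (x ∷ y ∷ v) = y ∷ x ∷ v
exchange zero    []          = []
exchange zero    (x ∷ [])    = x ∷ []
exchange (suc p) []          = []
exchange (suc p) (z ∷ u)     = z ∷ exchange p u

count-exchange : ∀ {n} (g : A → Bool) p (v : Vec A n) →
                 count (λ j → g (lookup (exchange p v) j)) ≡ count (λ j → g (lookup v j))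
count-exchange g zero    []          = refl
count-exchange g zero    (x ∷ [])    = refl
count-exchange g zero    (x ∷ y ∷ v) = x∙yz≈y∙xz (bit (g y)) (bit (g x)) _
count-exchange g (suc p) []          = refl
count-exchange g (suc p) (z ∷ u)     = cong (bit (g z) +_) (count-exchange g p u)

above-exchange : ∀ {m N} (z : Fin m) p (v : Vec (Fin m) N) → above z (exchange p v) ≡ above z v
above-exchange z = count-exchange (λ y → toℕ z <ᵇ toℕ y)

content-exchange : ∀ {m N} (c : Fin m) p (u : Vec (Fin m) N) → content (c ∷ exchange p u) ≡ content (c ∷ u)
content-exchange c p u = Vec.tabulate-cong λ col → begin
  length (filter (λ j → toℕ (lookup (c ∷ exchange p u) j) ≟ toℕ col) (allFin _))
    ≡⟨ length-filter-allFin (λ j → toℕ (lookup (c ∷ exchange p u) j) ≟ toℕ col) ⟩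
  count (λ j → does (toℕ (lookup (c ∷ exchange p u) j) ≟ toℕ col))
    ≡⟨ cong (bit (does (toℕ c ≟ toℕ col)) +_) (count-exchange (λ y → does (toℕ y ≟ toℕ col)) p u) ⟩
  count (λ j → does (toℕ (lookup (c ∷ u) j) ≟ toℕ col))
    ≡⟨ length-filter-allFin (λ j → toℕ (lookup (c ∷ u) j) ≟ toℕ col) ⟨
  length (filter (λ j → toℕ (lookup (c ∷ u) j) ≟ toℕ col) (allFin _)) ∎
  where open ≡.≡-Reasoning

-- The two-vertex identity behind the recurrence

_==ₚ_ : Poly → Poly → Bool
[]      ==ₚ []      = true
[]      ==ₚ (b ∷ r) = (b ≡ᵇ 0) ∧ ([] ==ₚ r)
(a ∷ p) ==ₚ []      = (a ≡ᵇ 0) ∧ (p ==ₚ [])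
(a ∷ p) ==ₚ (b ∷ r) = (a ≡ᵇ b) ∧ (p ==ₚ r)

==ₚ-sound : ∀ p r → T (p ==ₚ r) → p ≋ r
==ₚ-sound []      []      _ = ≋-refl
==ₚ-sound []      (b ∷ r) t with Equivalence.to T-∧ t
... | b≡0 , rest = by-coeffs λ { zero → ≡.sym (ℕ.≡ᵇ⇒≡ b 0 b≡0) ; (suc i) → coeffs (==ₚ-sound [] r rest) i }
==ₚ-sound (a ∷ p) []      t with Equivalence.to T-∧ t
... | a≡0 , rest = by-coeffs λ { zero → ℕ.≡ᵇ⇒≡ a 0 a≡0 ; (suc i) → coeffs (==ₚ-sound p [] rest) i }
==ₚ-sound (a ∷ p) (b ∷ r) t with Equivalence.to T-∧ t
... | a≡b , rest = by-coeffs λ { zero → ℕ.≡ᵇ⇒≡ a b a≡b ; (suc i) → coeffs (==ₚ-sound p r rest) i }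

by-evaluation : ∀ {p r} {_ : T (p ==ₚ r)} → p ≋ r
by-evaluation {p} {r} {t} = ==ₚ-sound p r t

<ᵇ-true : ∀ {a b} → a < b → (a <ᵇ b) ≡ true
<ᵇ-true a<b = Equivalence.to T-≡ (ℕ.<⇒<ᵇ a<b)

<ᵇ-false : ∀ {a b} → ¬ a < b → (a <ᵇ b) ≡ false
<ᵇ-false {a} {b} a≮b with a <ᵇ b in eq
... | false = refl
... | true  = ⊥-elim (a≮b (ℕ.<ᵇ⇒< a b (≡.subst T (≡.sym eq) tt)))

-- For two vertices x, y after vertex 1 (coloured c), with b = [κ(x) < κ(y)],
-- eₓ = [c < κ(x)] and e_y = [c < κ(y)], the contributions of the pair to
-- Φ(2) + q Φ(0) and to (1 + q) Φ(1) are q^b-multiples of these kernels.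
kernel₂ : Bool → Bool → Bool → Poly
kernel₂ b eₓ e_y = qpow (bit b + (bit eₓ + (bit e_y + 0))) ⊕ q ⊛ qpow (bit b + 0)

kernel₁ : Bool → Bool → Poly
kernel₁ b eₓ = qpow (bit b + (bit eₓ + 0)) ⊕ q ⊛ qpow (bit b + (bit eₓ + 0))

Balanced : Bool → Bool → Bool → Bool → Set
Balanced b b′ eₓ e_y = (kernel₂ b eₓ e_y ⊕ kernel₂ b′ e_y eₓ) ≋ (kernel₁ b eₓ ⊕ kernel₁ b′ e_y)

balanced-ordered : ∀ a b d → ¬ b < a → Balanced (a <ᵇ b) (b <ᵇ a) (d <ᵇ a) (d <ᵇ b)
balanced-ordered a b d b≮a with ℕ.<-cmp a b
... | tri< a<b _ _ rewrite <ᵇ-true a<b | <ᵇ-false b≮a = increasing (d <ᵇ a) (d <ᵇ b) monotone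
  where
  monotone : (d <ᵇ a) ≡ true → (d <ᵇ b) ≡ true
  monotone e = <ᵇ-true (ℕ.<-trans (ℕ.<ᵇ⇒< d a (≡.subst T (≡.sym e) tt)) a<b)
  increasing : ∀ eₓ e_y → (eₓ ≡ true → e_y ≡ true) → Balanced true false eₓ e_y
  increasing false false _ = by-evaluation
  increasing false true  _ = by-evaluation
  increasing true  true  _ = by-evaluation
  increasing true  false m with m refl
  ... | ()
... | tri≈ _ refl _ rewrite <ᵇ-false (ℕ.<-irrefl {a} refl) = equal (d <ᵇ a)
  where
  equal : ∀ e → Balanced false false e e
  equal false = by-evaluation
  equal true  = by-evaluation
... | tri> _ _ b<a = ⊥-elim (b≮a b<a)

balanced : ∀ a b d → Balanced (a <ᵇ b) (b <ᵇ a) (d <ᵇ a) (d <ᵇ b)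
balanced a b d with b ℕ.<? a
... | no  b≮a = balanced-ordered a b d b≮a
... | yes b<a = ≋-trans (⊕-comm (kernel₂ (a <ᵇ b) (d <ᵇ a) (d <ᵇ b)) (kernel₂ (b <ᵇ a) (d <ᵇ b) (d <ᵇ a)))
                  (≋-trans (balanced-ordered b a d (ℕ.<-asym b<a))
                           (⊕-comm (kernel₁ (b <ᵇ a) (d <ᵇ b)) (kernel₁ (a <ᵇ b) (d <ᵇ a))))

-- The local three-term recurrence

∑-allMaps-suc : ∀ {N m} (f : Vec (Fin m) (suc N) → Poly) →
                ∑ (allMaps (suc N) m) f ≋ ∑ (allFin m) (λ z → ∑ (allMaps N m) (λ v → f (z ∷ v)))
∑-allMaps-suc {N} {m} f = ≋-trans (∑-concatMap (allFin m) (λ z → map (z ∷_) (allMaps N m)) f)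
                                  (∑-cong (allFin m) λ z → ≋-reflexive (∑-map (allMaps N m) (z ∷_) f))

⊛-qpow-+ : ∀ x a b → (x ⊛ qpow (a + b)) ≋ ((x ⊛ qpow a) ⊛ qpow b)
⊛-qpow-+ x a b = ≋-trans (⊛-congˡ x (qpow-+ a b)) (≋-sym (⊛-assoc x (qpow a) (qpow b)))

module Local {m : ℕ} (c : Fin m) where

  -- Colourings u of the N vertices after vertex 1 (which has colour c), weighted
  -- by w, when vertex 1 is adjacent to the first d of them.
  F : ∀ {N} → (Vec (Fin m) N → Poly) → ℕ → Poly
  F {N} w d = ∑ (allMaps N m) (λ u → w u ⊛ qpow (prefix c d u + asc (K N) u))

  -- Splitting off the first vertex after vertex 1, coloured z: its ascents
  -- from vertex 1 and towards the later vertices move into the weight.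
  peel-weight : ∀ {N} → (Vec (Fin m) (suc N) → Poly) → Fin m → Vec (Fin m) N → Poly
  peel-weight w z v = w (z ∷ v) ⊛ qpow (bit (toℕ c <ᵇ toℕ z) + above z v)

  peel : ∀ {N} (w : Vec (Fin m) (suc N) → Poly) d → F w (suc d) ≋ ∑ (allFin m) (λ z → F (peel-weight w z) d)
  peel {N} w d = ≋-trans (∑-allMaps-suc summand) (∑-cong (allFin m) λ z → ∑-cong (allMaps N m) λ v →
    ≋-trans (⊛-congˡ (w (z ∷ v)) (≋-reflexive (cong qpow (exponent z v))))
            (⊛-qpow-+ (w (z ∷ v)) (bit (toℕ c <ᵇ toℕ z) + above z v) (prefix c d v + asc (K N) v)))
    where
    summand : Vec (Fin m) (suc N) → Poly
    summand u = w u ⊛ qpow (prefix c (suc d) u + asc (K (suc N)) u)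
    exponent : ∀ z v → prefix c (suc d) (z ∷ v) + asc (K (suc N)) (z ∷ v)
                     ≡ (bit (toℕ c <ᵇ toℕ z) + above z v) + (prefix c d v + asc (K N) v)
    exponent z v = ≡.trans (cong (prefix c (suc d) (z ∷ v) +_) (asc-K-cons z v))
                           (interchange (bit (toℕ c <ᵇ toℕ z)) (prefix c d v) (above z v) (asc (K N) v))

  module Pair {N} (w : Vec (Fin m) (suc (suc N)) → Poly) where

    -- the weight of the remaining vertices, with the ascents from x and y towards them
    h : Fin m → Fin m → Poly
    h x y = ∑ (allMaps N m) (λ v → w (x ∷ y ∷ v) ⊛ qpow ((above x v + above y v) + asc (K N) v))

    h-symmetric : (∀ u → w (exchange 0 u) ≋ w u) → ∀ x y → h x y ≋ h y x
    h-symmetric invariant x y = ∑-cong (allMaps N m) λ v →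
      ⊛-cong (invariant (y ∷ x ∷ v)) (≋-reflexive (cong (λ e → qpow (e + asc (K N) v)) (ℕ.+-comm (above x v) (above y v))))

    -- For d ≤ 2 the prefix count only sees x and y, so F w d is a double sum
    -- over their colours of h against a power of q.
    expand : ∀ d (s : Fin m → Fin m → ℕ) → (∀ x y v → prefix c d (x ∷ y ∷ v) ≡ s x y) →
             F w d ≋ ∑₂ (allFin m) (λ x y → h x y ⊛ qpow (bit (toℕ x <ᵇ toℕ y) + s x y))
    expand d s prefix≡ = ≋-trans (∑-allMaps-suc summand) (∑-cong (allFin m) λ x →
      ≋-trans (∑-allMaps-suc (λ u → summand (x ∷ u))) (∑-cong (allFin m) λ y →
      ≋-trans (∑-cong (allMaps N m) λ v →
                 ≋-trans (⊛-congˡ (w (x ∷ y ∷ v)) (≋-reflexive (cong qpow (exponent x y v))))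
                         (⊛-qpow-+ (w (x ∷ y ∷ v)) ((above x v + above y v) + asc (K N) v) (bit (toℕ x <ᵇ toℕ y) + s x y)))
              (∑-⊛ʳ (allMaps N m) (qpow (bit (toℕ x <ᵇ toℕ y) + s x y)) _)))
      where
      summand : Vec (Fin m) (suc (suc N)) → Poly
      summand u = w u ⊛ qpow (prefix c d u + asc (K (suc (suc N))) u)
      regroup : ∀ s b a₁ a₂ r → s + ((b + a₁) + (a₂ + r)) ≡ ((a₁ + a₂) + r) + (b + s)
      regroup = solve-∀
      exponent : ∀ x y v → prefix c d (x ∷ y ∷ v) + asc (K (suc (suc N))) (x ∷ y ∷ v)
                         ≡ ((above x v + above y v) + asc (K N) v) + (bit (toℕ x <ᵇ toℕ y) + s x y)
      exponent x y v = ≡.trans (cong₂ _+_ (prefix≡ x y v) (≡.trans (asc-K-cons x (y ∷ v)) (cong (above x (y ∷ v) +_) (asc-K-cons y v))))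
                               (regroup (s x y) (bit (toℕ x <ᵇ toℕ y)) (above x v) (above y v) (asc (K N) v))

  local-recurrence : ∀ p {N} (w : Vec (Fin m) N → Poly) → (∀ u → w (exchange p u) ≋ w u) → suc (suc p) ≤ N →
                     Recurrence (F w (suc (suc p))) (F w (suc p)) (F w p)
  local-recurrence zero    {suc (suc N)} w invariant _ = begin
    F w 2 ⊕ q ⊛ F w 0
      ≈⟨ ⊕-cong (expand 2 _ λ _ _ _ → refl) (⊛-congˡ q (expand 0 _ λ _ _ _ → refl)) ⟩
    ∑₂ xs (λ x y → h x y ⊛ T₂ x y) ⊕ q ⊛ ∑₂ xs (λ x y → h x y ⊛ T₀ x y)
      ≈⟨ ∑₂-linear xs q _ _ ⟨
    ∑₂ xs (λ x y → h x y ⊛ T₂ x y ⊕ q ⊛ (h x y ⊛ T₀ x y))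
      ≈⟨ ∑-cong xs (λ x → ∑-cong xs λ y → solve 4 (λ h T₂ T₀ q → h :* T₂ :+ q :* (h :* T₀) := h :* (T₂ :+ q :* T₀))
                                                 ≋-refl (h x y) (T₂ x y) (T₀ x y) q) ⟩
    ∑₂ xs (λ x y → h x y ⊛ kernel₂ (toℕ x <ᵇ toℕ y) (toℕ c <ᵇ toℕ x) (toℕ c <ᵇ toℕ y))
      ≈⟨ symmetrise xs h _ _ (h-symmetric invariant) (λ x y → balanced (toℕ x) (toℕ y) (toℕ c)) ⟩
    ∑₂ xs (λ x y → h x y ⊛ kernel₁ (toℕ x <ᵇ toℕ y) (toℕ c <ᵇ toℕ x))
      ≈⟨ ∑-cong xs (λ x → ∑-cong xs λ y → solve 3 (λ h T₁ q → h :* (T₁ :+ q :* T₁) := h :* T₁ :+ q :* (h :* T₁))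
                                                 ≋-refl (h x y) (T₁ x y) q) ⟩
    ∑₂ xs (λ x y → h x y ⊛ T₁ x y ⊕ q ⊛ (h x y ⊛ T₁ x y))
      ≈⟨ ∑₂-linear xs q _ _ ⟩
    ∑₂ xs (λ x y → h x y ⊛ T₁ x y) ⊕ q ⊛ ∑₂ xs (λ x y → h x y ⊛ T₁ x y)
      ≈⟨ ⊕-cong (expand 1 _ λ _ _ _ → refl) (⊛-congˡ q (expand 1 _ λ _ _ _ → refl)) ⟨
    F w 1 ⊕ q ⊛ F w 1 ∎
    where
    open ≋-Reasoning
    open Pair w
    xs = allFin m
    T₂ T₁ T₀ : Fin m → Fin m → Poly
    T₂ x y = qpow (bit (toℕ x <ᵇ toℕ y) + (bit (toℕ c <ᵇ toℕ x) + (bit (toℕ c <ᵇ toℕ y) + 0)))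
    T₁ x y = qpow (bit (toℕ x <ᵇ toℕ y) + (bit (toℕ c <ᵇ toℕ x) + 0))
    T₀ x y = qpow (bit (toℕ x <ᵇ toℕ y) + 0)
  local-recurrence zero    {zero}        _ _ ()
  local-recurrence zero    {suc zero}    _ _ (s≤s ())
  local-recurrence (suc p) {suc N} w invariant (s≤s le) =
    Recurrence-cong (≋-sym (peel w (suc (suc p)))) (≋-sym (peel w (suc p))) (≋-sym (peel w p))
      (Recurrence-∑ (allFin m) _ _ _ λ z → local-recurrence p (peel-weight w z) (peeled-invariant z) le)
    where
    peeled-invariant : ∀ z v → peel-weight w z (exchange p v) ≋ peel-weight w z v
    peeled-invariant z v = ⊛-cong (invariant (z ∷ v))
      (≋-reflexive (cong (λ e → qpow (bit (toℕ c <ᵇ toℕ z) + e)) (above-exchange z p v)))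

-- The LLT coefficients of K_{N+1} and K_{N+1}^{(k)} as terms of one sequence

module Coefficients {m : ℕ} (α : Vec ℕ m) (N : ℕ) where

  has-content : Fin m → Vec (Fin m) N → Poly
  has-content c u = if ⌊ Vec.≡-dec _≟_ (content (c ∷ u)) α ⌋ then [ 1 ] else []

  -- Φ d is the coefficient of x^α in the LLT polynomial of the graph on N + 1
  -- vertices in which vertex 1 is adjacent to vertices 2, …, d + 1 only, and
  -- all other pairs of vertices are adjacent.
  Φ : ℕ → Poly
  Φ d = ∑ (allFin m) (λ c → Local.F c (has-content c) d)

  Φ-recurrence : ∀ p → suc (suc p) ≤ N → Recurrence (Φ (suc (suc p))) (Φ (suc p)) (Φ p)
  Φ-recurrence p le = Recurrence-∑ (allFin m) _ _ _ λ c →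
    Local.local-recurrence c p (has-content c) (λ u → ≋-reflexive (cong (λ κ → if ⌊ Vec.≡-dec _≟_ κ α ⌋ then [ 1 ] else [])
                                                                          (content-exchange c p u))) le

  LLT-Φ : ∀ (G : Graph (suc N)) d → (∀ c u → asc G (c ∷ u) ≡ prefix c d u + asc (K N) u) → LLTcoeff G α ≋ Φ d
  LLT-Φ G d asc≡ = ≋-trans (∑-allMaps-suc monomial) (∑-cong (allFin m) λ c → ∑-cong (allMaps N m) λ u → term c u)
    where
    monomial : Vec (Fin m) (suc N) → Poly
    monomial κ = if ⌊ Vec.≡-dec _≟_ (content κ) α ⌋ then qpow (asc G κ) else []
    term : ∀ c u → monomial (c ∷ u) ≋ (has-content c u ⊛ qpow (prefix c d u + asc (K N) u))
    term c u with ⌊ Vec.≡-dec _≟_ (content (c ∷ u)) α ⌋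
    ... | true  = ≋-trans (≋-reflexive (cong qpow (asc≡ c u))) (≋-sym (⊛-identityˡ _))
    ... | false = ≋-refl

  LLT-K : LLTcoeff (K (suc N)) α ≋ Φ N
  LLT-K = LLT-Φ (K (suc N)) N asc-K

  LLT-Kk : ∀ k → k ≤ N → LLTcoeff (Kk (suc N) k) α ≋ Φ (N ∸ k)
  LLT-Kk k k≤N = LLT-Φ (Kk (suc N) k) (N ∸ k) (asc-Kk k k≤N)

  open ThreeTerm Φ N Φ-recurrence

  LLT-interpolation : ∀ k ℓ → k ≤ ℓ → ℓ ≤ N →
    (qint (ℓ ∸ k) ⊛ LLTcoeff (K (suc N)) α ⊕ qpow (ℓ ∸ k) ⊛ qint k ⊛ LLTcoeff (Kk (suc N) ℓ) α)
      ≋ (qint ℓ ⊛ LLTcoeff (Kk (suc N) k) α)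
  LLT-interpolation k ℓ k≤ℓ ℓ≤N = begin
    qint (ℓ ∸ k) ⊛ LLTcoeff (K (suc N)) α ⊕ (qpow (ℓ ∸ k) ⊛ qint k) ⊛ LLTcoeff (Kk (suc N) ℓ) α
      ≈⟨ ⊕-cong (⊛-congˡ (qint (ℓ ∸ k)) (≋-trans LLT-K (≋-reflexive (cong Φ (≡.sym top)))))
                (⊛-congˡ (qpow (ℓ ∸ k) ⊛ qint k) (LLT-Kk ℓ ℓ≤N)) ⟩
    qint (ℓ ∸ k) ⊛ Φ ((N ∸ ℓ) + ((ℓ ∸ k) + k)) ⊕ (qpow (ℓ ∸ k) ⊛ qint k) ⊛ Φ (N ∸ ℓ)
      ≈⟨ interpolation (N ∸ ℓ) (ℓ ∸ k) k (ℕ.≤-reflexive top) ⟩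
    qint ((ℓ ∸ k) + k) ⊛ Φ ((N ∸ ℓ) + (ℓ ∸ k))
      ≈⟨ ⊛-cong (≋-reflexive (cong qint (ℕ.m∸n+n≡m k≤ℓ)))
                (≋-trans (≋-reflexive (cong Φ middle)) (≋-sym (LLT-Kk k (ℕ.≤-trans k≤ℓ ℓ≤N)))) ⟩
    qint ℓ ⊛ LLTcoeff (Kk (suc N) k) α ∎
    where
    open ≋-Reasoning
    top : (N ∸ ℓ) + ((ℓ ∸ k) + k) ≡ N
    top = ≡.trans (cong ((N ∸ ℓ) +_) (ℕ.m∸n+n≡m k≤ℓ)) (ℕ.m∸n+n≡m ℓ≤N)
    middle : (N ∸ ℓ) + (ℓ ∸ k) ≡ N ∸ k
    middle = ≡.trans (≡.sym (ℕ.+-∸-assoc (N ∸ ℓ) k≤ℓ)) (cong (_∸ k) (ℕ.m∸n+n≡m ℓ≤N))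

-- The case ℓ = n - 1, k = n - 2, where [ℓ - k]_q = 1.
first-identity : ∀ (n : ℕ) → 2 ≤ n → ∀ (m : ℕ) (α : Vec ℕ m) →
  (LLTcoeff (K n) α ⊕ qpow 1 ⊛ qint (n ∸ 2) ⊛ LLTcoeff (Kk n (n ∸ 1)) α)
    ≈ₚ (qint (n ∸ 1) ⊛ LLTcoeff (Kk n (n ∸ 2)) α)
first-identity (suc N) (s≤s 1≤N) m α =
  coeffs (≋-trans (⊕-congʳ (qpow 1 ⊛ qint (N ∸ 1) ⊛ LLTcoeff (Kk (suc N) N) α) (≋-sym (⊛-identityˡ _)))
                  (≡.subst (λ a → (qint a ⊛ LLTcoeff (K (suc N)) α ⊕ qpow a ⊛ qint (N ∸ 1) ⊛ LLTcoeff (Kk (suc N) N) α)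
                                    ≋ (qint N ⊛ LLTcoeff (Kk (suc N) (N ∸ 1)) α))
                           (ℕ.m∸[m∸n]≡n 1≤N)
                           (Coefficients.LLT-interpolation α N (N ∸ 1) N (ℕ.m∸n≤m N 1) ℕ.≤-refl)))

-- The general case; only k < ℓ < n is used.
second-identity : ∀ (n ℓ k : ℕ) → 2 ≤ ℓ → ℓ + 1 ≤ n → 1 ≤ k → k + 1 ≤ ℓ → ∀ (m : ℕ) (α : Vec ℕ m) →
  (qint (ℓ ∸ k) ⊛ LLTcoeff (K n) α ⊕ qpow (ℓ ∸ k) ⊛ qint k ⊛ LLTcoeff (Kk n ℓ) α)
    ≈ₚ (qint ℓ ⊛ LLTcoeff (Kk n k) α)
second-identity zero    ℓ k _ ℓ+1≤n _ _ _ _ with ℕ.m+n≤o⇒n≤o ℓ ℓ+1≤n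
... | ()
second-identity (suc N) ℓ k _ ℓ+1≤n _ k+1≤ℓ m α =
  coeffs (Coefficients.LLT-interpolation α N k ℓ (ℕ.≤-trans (ℕ.m≤m+n k 1) k+1≤ℓ)
                                                 (s≤s⁻¹ (≡.subst (_≤ suc N) (ℕ.+-comm ℓ 1) ℓ+1≤n)))

proposition5p6 :
    (∀ (n : ℕ) → 2 ≤ n → ∀ (m : ℕ) (α : Vec ℕ m) →
      (LLTcoeff (K n) α ⊕ qpow 1 ⊛ qint (n ∸ 2) ⊛ LLTcoeff (Kk n (n ∸ 1)) α)
        ≈ₚ (qint (n ∸ 1) ⊛ LLTcoeff (Kk n (n ∸ 2)) α))
    ×
    (∀ (n ℓ k : ℕ) → 2 ≤ ℓ → ℓ + 1 ≤ n → 1 ≤ k → k + 1 ≤ ℓ → ∀ (m : ℕ) (α : Vec ℕ m) →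
      (qint (ℓ ∸ k) ⊛ LLTcoeff (K n) α ⊕ qpow (ℓ ∸ k) ⊛ qint k ⊛ LLTcoeff (Kk n ℓ) α)
        ≈ₚ (qint ℓ ⊛ LLTcoeff (Kk n k) α))
proposition5p6 = first-identity , second-identity
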